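{- (a) Let $T$ be an $N$-colored proper layered planar tree. The breadth first ordering $\ll$ coincides with the ordering $\triangleleft_R$ on the set of non-degenerate vertices of $T$ if and only if $T$ is simple and order reduced. (b) For all $i\in\langle N\rangle$ and $u\in\langle N\rangle^*$, the contraction map $\rho$ restricts to a bijection of $\mathbf{OST}_u^i$ onto $\mathbf{RT}_u^i$. (c) If $T\in\mathbf{RT}_u^i$ and $T'$ is the unique element of $\mathbf{OST}_u^i$ with $\rho(T')=T$, then $\Omega(T')=\Lambda_{\uparrow R}(T)$ and $\ell(T')=\mathbf v(T)$.
   Context: $N\ge1$, $\langle N\rangle=\{1,\ldots,N\}$, $\langle N\rangle^*$ the words over $\langle N\rangle$. $\mathcal H$ is the free unital associative algebra over $\mathbb C$ on symbols $Y_u^i$ ($i\in\langle N\rangle$, $|u|\ge2$), with the convention $Y_j^i=\delta_{ij}1$ for $i,j\in\langle N\rangle$. Trees: a planar rooted tree is a finite rooted tree with the children of each vertex linearly ordered left to right; leaves (vertices without children) are read left to right in the induced planar order, and the vertices at each depth (level) are linearly ordered left to right. An $N$-coloring assigns each vertex $x$ a color $c(x)\in\langle N\rangle$ such that if $x$ has exactly one child $y$ then $c(y)=c(x)$. A vertex is unary if it has exactly one child and non-degenerate if it has at least two children. A tree is reduced if it has no unary vertex. A tree is layered if all leaves lie at the same (maximal) depth; a layered tree is proper if every level other than the leaf level contains a non-degenerate vertex, and simple if each level contains at most one non-degenerate vertex. $\ell(T)$ is the depth of the leaves of a layered tree. $\mathbf v(T)$ is the number of non-leaf vertices. For a non-leaf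 vertex $x$ with children colored $w(1),\ldots,w(k)$ left to right, $Y(x)=Y^{c(x)}_{w(1)\cdots w(k)}$. Breadth first order: $x\ll y$ if $x$ has greater depth than $y$, or the same depth and lies to the left of $y$; $\Omega(T)=Y(x_1)\cdots Y(x_k)$ with $x_1\ll\cdots\ll x_k$ the non-degenerate vertices. For distinct vertices $x,y$ write $x\triangleleft_R y$ if either $y$ is an ancestor of $x$, or neither is an ancestor of the other and, with $z$ their nearest common ancestor, the child of $z$ on the path to $x$ lies to the right of the child of $z$ on the path to $y$; $\Lambda_{\uparrow R}(T)=Y(y_1)\cdots Y(y_r)$ where $y_1\triangleleft_R\cdots\triangleleft_R y_r$ are the non-leaf vertices. For a proper layered tree $T$ and a non-degenerate non-root vertex $x$ at depth $k$ with parent $x'$, $T$ is order contractible at $x$ if (a) $x'$ is unary, (b) no non-degenerate vertex at depth $k$ lies to the right of $x$, and (c) no non-degenerate vertex at depth $k-1$ lies to the left of $x'$; $T$ is order reduced if it is order contractible at no vertex. $\mathbf{OST}_u^i$ (resp. $\mathbf{RT}_u^i$) is the set of isomorphism classes of $N$-colored proper layered simple order reduced trees (resp. reduced trees) with root colored $i$ and leaves colored, left to right, $u(1),\ldots,u(|u|)$. For a tree $T$, $\rho(T)$ is the reduced tree obtained by contracting every edge joining a unary vertex to its child (identifying the two endpoints, which have the same color). -}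

module Defs where

open import Data.Nat using (ℕ; zero; suc; _<_; _≤_; _⊔_; _+_)
open import Data.Fin using (Fin)
open import Data.List using (List; []; _∷_; _++_; length; _∷ʳ_; concat; map; downFrom)
open import Data.Maybe using (Maybe; just; nothing)
open import Data.Product using (Σ; _×_; _,_; ∃)
open import Data.Sum using (_⊎_)
open import Data.Unit using (⊤)
open import Data.Empty using (⊥)
open import Relation.Nullary using (¬_)
open import Relation.Binary.PropositionalEquality using (_≡_)

-- Two planar rooted
-- trees are isomorphic iff they are equal as terms, so isomorphism
-- classes are just elements of  Tree N  and equality is  _≡_ .

data Tree (N : ℕ) : Set where
  node : Fin N → List (Tree N) → Tree N

module _ {N : ℕ} where

  colour : Tree N → Fin N
  colour (node c _) = c

  kids : Tree N → List (Tree N)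
  kids (node _ ts) = ts

  Colored : Tree N → Set
  ColoredL : List (Tree N) → Set
  Colored (node c []) = ⊤
  Colored (node c (t ∷ [])) = colour t ≡ c × Colored t
  Colored (node c ts@(_ ∷ _ ∷ _)) = ColoredL ts
  ColoredL [] = ⊤
  ColoredL (t ∷ ts) = Colored t × ColoredL ts

  leafWord : Tree N → List (Fin N)
  leafWordL : List (Tree N) → List (Fin N)
  leafWord (node c []) = c ∷ []
  leafWord (node c ts@(_ ∷ _)) = leafWordL ts
  leafWordL [] = []
  leafWordL (t ∷ ts) = leafWord t ++ leafWordL ts

  -- Vertices are addressed by paths: the list of child indices (0-based,
  -- left to right) from the root.  The depth of a vertex is the length
  -- of its path.

  Path : Set
  Path = List ℕ

  nth : List (Tree N) → ℕ → Maybe (Tree N)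
  nth [] _ = nothing
  nth (t ∷ ts) zero = just t
  nth (t ∷ ts) (suc i) = nth ts i

  _at_ : Tree N → Path → Maybe (Tree N)
  t at [] = just t
  node c ts at (i ∷ p) with nth ts i
  ... | nothing = nothing
  ... | just s = s at p

  Vertex : Tree N → Path → Set
  Vertex T p = Σ (Tree N) λ s → T at p ≡ just s

  IsLeaf : Tree N → Path → Set
  IsLeaf T p = Σ (Tree N) λ s → (T at p ≡ just s) × (kids s ≡ [])

  NonLeaf : Tree N → Path → Set
  NonLeaf T p = Σ (Tree N) λ s → (T at p ≡ just s) × (1 ≤ length (kids s))

  Unary : Tree N → Path → Set
  Unary T p = Σ (Tree N) λ s → (T at p ≡ just s) × (length (kids s) ≡ 1)

  NonDeg : Tree N → Path → Set
  NonDeg T p = Σ (Tree N) λ s → (T at p ≡ just s) × (2 ≤ length (kids s))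

  data _AncestorOf_ : Path → Path → Set where
    anc-here  : ∀ {i p} → [] AncestorOf (i ∷ p)
    anc-there : ∀ {i p q} → p AncestorOf q → (i ∷ p) AncestorOf (i ∷ q)

  data _LeftOf_ : Path → Path → Set where
    left-here  : ∀ {i j p q} → i < j → (i ∷ p) LeftOf (j ∷ q)
    left-there : ∀ {i p q} → p LeftOf q → (i ∷ p) LeftOf (i ∷ q)

  _≪_ : Path → Path → Set
  x ≪ y = (length y < length x) ⊎ ((length x ≡ length y) × (x LeftOf y))

  _◁R_ : Path → Path → Set
  x ◁R y = (y AncestorOf x) ⊎ (y LeftOf x)

  -- depth of the tree (maximal depth of a vertex); for a layered tree
  -- this is the common depth  ℓ(T)  of the leaves
  height : Tree N → ℕ
  heightL : List (Tree N) → ℕ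
  height (node c []) = 0
  height (node c ts@(_ ∷ _)) = suc (heightL ts)
  heightL [] = 0
  heightL (t ∷ ts) = height t ⊔ heightL ts

  ℓ : Tree N → ℕ
  ℓ = height

  nonLeafCount : Tree N → ℕ
  nonLeafCountL : List (Tree N) → ℕ
  nonLeafCount (node c []) = 0
  nonLeafCount (node c ts@(_ ∷ _)) = suc (nonLeafCountL ts)
  nonLeafCountL [] = 0
  nonLeafCountL (t ∷ ts) = nonLeafCount t + nonLeafCountL ts

  Layered : Tree N → Set
  Layered T = ∀ p q → IsLeaf T p → IsLeaf T q → length p ≡ length q

  Proper : Tree N → Set
  Proper T = ∀ k → k < ℓ T → Σ Path λ p → (length p ≡ k) × NonDeg T p

  ProperLayered : Tree N → Set
  ProperLayered T = Layered T × Proper T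

  Simple : Tree N → Set
  Simple T = ∀ p q → NonDeg T p → NonDeg T q → length p ≡ length q → p ≡ q

  OrderContractible : Tree N → Path → Set
  OrderContractible T x =
    NonDeg T x × Σ Path λ x' → Σ ℕ λ j → (x ≡ x' ∷ʳ j) ×
      Unary T x' ×
      (∀ z → NonDeg T z → length z ≡ length x → ¬ (x LeftOf z)) ×
      (∀ z → NonDeg T z → length z ≡ length x' → ¬ (z LeftOf x'))

  OrderReduced : Tree N → Set
  OrderReduced T = ∀ x → ¬ OrderContractible T x

  Reduced : Tree N → Set
  Reduced T = ∀ p → ¬ Unary T p

  OST : Fin N → List (Fin N) → Tree N → Set
  OST i u T = Colored T × Layered T × Proper T × Simple T × OrderReduced T ×
              (colour T ≡ i) × (leafWord T ≡ u)

  RT : Fin N → List (Fin N) → Tree N → Set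
  RT i u T = Colored T × Reduced T × (colour T ≡ i) × (leafWord T ≡ u)

  ρ : Tree N → Tree N
  ρL : List (Tree N) → List (Tree N)
  ρ (node c (t ∷ [])) = ρ t
  ρ (node c []) = node c []
  ρ (node c ts@(_ ∷ _ ∷ _)) = node c (ρL ts)
  ρL [] = []
  ρL (t ∷ ts) = ρ t ∷ ρL ts

  -- Generators Y^i_w of the free algebra H (with |w| ≥ 2); a product of
  -- such generators is a monomial of H, represented by the list of its
  -- letters (distinct words give distinct elements of the free algebra).
  Gen : Set
  Gen = Fin N × List (Fin N)

  Y : Tree N → Gen
  Y (node c ts) = c , map colour ts

  level : ℕ → Tree N → List (Tree N)
  levelL : ℕ → List (Tree N) → List (Tree N)
  level zero t = t ∷ []
  level (suc k) (node c ts) = levelL k ts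
  levelL k [] = []
  levelL k (t ∷ ts) = level k t ++ levelL k ts

  nonDegY : List (Tree N) → List Gen
  nonDegY [] = []
  nonDegY (node c [] ∷ ts) = nonDegY ts
  nonDegY (node c (_ ∷ []) ∷ ts) = nonDegY ts
  nonDegY (t@(node c (_ ∷ _ ∷ _)) ∷ ts) = Y t ∷ nonDegY ts

  -- Ω(T): product of Y(x) over non-degenerate x in breadth first order ≪
  -- (deepest level first, each level left to right)
  Ω : Tree N → List Gen
  Ω T = concat (map (λ k → nonDegY (level k T)) (downFrom (suc (height T))))

  -- Λ↑R(T): product of Y(y) over non-leaf y in ◁R order, i.e. a
  -- post-order traversal visiting the children from right to left
  ΛR : Tree N → List Gen
  ΛRL : List (Tree N) → List Gen
  ΛR (node c []) = []
  ΛR t@(node c ts@(_ ∷ _)) = ΛRL ts ++ (Y t ∷ [])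
  ΛRL [] = []
  ΛRL (t ∷ ts) = ΛRL ts ++ ΛR t

module Submission where

open import Data.Empty using (⊥; ⊥-elim)
open import Data.Fin using (Fin)
open import Data.List using (List; []; _∷_; _++_; length; _∷ʳ_; concat; map; downFrom; initLast; _∷ʳ′_)
open import Data.List.Properties using (∷-injective; ++-identityʳ; ++-assoc)
open import Data.Maybe using (Maybe; just; nothing)
open import Data.Nat using (ℕ; zero; suc; _<_; _≤_; _+_; _∸_; z≤n; s≤s; s≤s⁻¹; _<?_; _≤?_)
open import Data.Nat.Properties
open import Data.Nat.Tactic.RingSolver using (solve-∀)
open import Data.Product using (Σ; _×_; _,_; proj₁; proj₂; map₁) renaming (map to map×)
open import Data.Sum using (_⊎_; inj₁; inj₂; map₂) renaming (map to map⊎)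
open import Data.Unit using (⊤; tt)
open import Defs
open import Function.Base using (_∘_)
open import Function.Bundles using (_⇔_; mk⇔; Equivalence)
open import Relation.Binary.Definitions using (tri<; tri≈; tri>)
open import Relation.Binary.PropositionalEquality
open import Relation.Nullary using (¬_; Dec; yes; no)

-- Cut
-- below a vertex, the non-degenerate vertices of the subtrees of its children occupy
-- consecutive blocks of levels, the leftmost child's block on top: otherwise some unary
-- vertex with a non-degenerate child would have the non-degenerate vertex of its own
-- level on its right, which order reducedness forbids.  Conversely every reduced tree is
-- the contraction of the tree that lays out its non-leaf vertices one per level in
-- exactly this way, padded with unary vertices.  Read bottom-up, that layout lists the
-- non-leaf vertices in ◁R order, whence Ω = Λ↑R and ℓ = v.  For (a), in a simple
-- order-reduced tree every non-degenerate vertex x satisfies x ◁R z for the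
-- non-degenerate vertex z of the level just above it, for the same reason, and ◁R is
-- transitive.

length-∷ʳ : ∀ {A : Set} (xs : List A) x → length (xs ∷ʳ x) ≡ suc (length xs)
length-∷ʳ [] x = refl
length-∷ʳ (y ∷ xs) x = cong suc (length-∷ʳ xs x)

upward-closed-threshold : ∀ n (Q : ℕ → Set) → (∀ k → k < n → Dec (Q k)) →
  (∀ k → suc k < n → Q k → Q (suc k)) →
  Σ ℕ λ m → (m ≤ n) × (∀ k → k < m → ¬ Q k) × (∀ k → m ≤ k → k < n → Q k)
upward-closed-threshold zero Q dec up = 0 , z≤n , (λ _ ()) , (λ _ _ ())
upward-closed-threshold (suc n) Q dec up with dec 0 (s≤s z≤n)
... | yes q₀ = 0 , z≤n , (λ _ ()) , (λ k _ → propagate k)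
  where
  propagate : ∀ k → k < suc n → Q k
  propagate zero _ = q₀
  propagate (suc k) k<n = up k k<n (propagate k (<-trans (n<1+n k) k<n))
... | no ¬q₀
  with upward-closed-threshold n (λ k → Q (suc k)) (λ k k<n → dec (suc k) (s≤s k<n)) (λ k k<n → up (suc k) (s≤s k<n))
... | m , m≤n , below , above = suc m , s≤s m≤n , below′ , above′
  where
  below′ : ∀ k → k < suc m → ¬ Q k
  below′ zero _ = ¬q₀
  below′ (suc k) (s≤s k<m) = below k k<m
  above′ : ∀ k → suc m ≤ k → k < suc n → Q k
  above′ (suc k) (s≤s m≤k) (s≤s k<n) = above k m≤k k<n

m≤n⇒n<m+o⇒n∸m<o : ∀ {a l m} → a ≤ l → l < a + m → l ∸ a < m
m≤n⇒n<m+o⇒n∸m<o {a} {l} {m} a≤l l<a+m =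
  +-cancelˡ-< a (l ∸ a) m (subst (_< a + m) (sym (m+[n∸m]≡n a≤l)) l<a+m)

a+[m+n]+o≡a+m+[o+n] : ∀ a m n o → a + (m + n) + o ≡ a + m + (o + n)
a+[m+n]+o≡a+m+[o+n] = solve-∀

a+[m+n]+o≡a+m+n+o : ∀ a m n o → a + (m + n) + o ≡ a + m + n + o
a+[m+n]+o≡a+m+n+o = solve-∀

concatDown : ∀ {A : Set} → (ℕ → List A) → ℕ → List A
concatDown f m = concat (map f (downFrom m))

concatDown-suc : ∀ {A : Set} (f : ℕ → List A) m → concatDown f (suc m) ≡ concatDown (λ k → f (suc k)) m ++ f 0
concatDown-suc f zero = ++-identityʳ (f 0)
concatDown-suc f (suc m) =
  trans (cong (f (suc m) ++_) (concatDown-suc f m)) (sym (++-assoc (f (suc m)) (concatDown (λ k → f (suc k)) m) (f 0)))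

concatDown-[] : ∀ {A : Set} (f : ℕ → List A) m → (∀ k → k < m → f k ≡ []) → concatDown f m ≡ []
concatDown-[] f zero _ = refl
concatDown-[] f (suc m) f≡[] rewrite f≡[] m ≤-refl = concatDown-[] f m (λ k k<m → f≡[] k (m<n⇒m<1+n k<m))

concatDown-cong : ∀ {A : Set} {f g : ℕ → List A} m → (∀ k → f k ≡ g k) → concatDown f m ≡ concatDown g m
concatDown-cong zero _ = refl
concatDown-cong (suc m) f≡g = cong₂ _++_ (f≡g m) (concatDown-cong m f≡g)

concatDown-++ : ∀ {A : Set} (f g : ℕ → List A) c m →
  (∀ k → c ≤ k → f k ≡ []) → (∀ k → k < c → g k ≡ []) →
  concatDown (λ k → f k ++ g k) m ≡ concatDown g m ++ concatDown f m
concatDown-++ f g c zero _ _ = refl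
concatDown-++ f g c (suc m) f≡[] g≡[] with c ≤? m
... | yes c≤m rewrite f≡[] m c≤m | concatDown-++ f g c m f≡[] g≡[] =
  sym (++-assoc (g m) (concatDown g m) (concatDown f m))
... | no c≰m rewrite g≡[] m (≰⇒> c≰m) | concatDown-++ f g c m f≡[] g≡[]
      | concatDown-[] g m (λ k k<m → g≡[] k (<-trans k<m (≰⇒> c≰m))) =
  cong (_++ concatDown f m) (++-identityʳ (f m))

Outside : ℕ → ℕ → ℕ → Set
Outside a n k = (k < a) ⊎ (a + n ≤ k)

module _ {N : ℕ} where

  _⊏_ : List ℕ → List ℕ → Set
  _⊏_ = _AncestorOf_ {N}

  _≺_ : List ℕ → List ℕ → Set
  _≺_ = _LeftOf_ {N}

  ⊏-shorter : ∀ {y x} → y ⊏ x → length y < length x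
  ⊏-shorter anc-here = s≤s z≤n
  ⊏-shorter (anc-there a) = s≤s (⊏-shorter a)

  ⊏-trans : ∀ {x y z} → x ⊏ y → y ⊏ z → x ⊏ z
  ⊏-trans anc-here (anc-there _) = anc-here
  ⊏-trans (anc-there a) (anc-there b) = anc-there (⊏-trans a b)

  ⊏-∷ʳ : ∀ x j → x ⊏ (x ∷ʳ j)
  ⊏-∷ʳ [] j = anc-here
  ⊏-∷ʳ (i ∷ x) j = anc-there (⊏-∷ʳ x j)

  ⊏-∷ʳ-sameLength : ∀ z x j → z ⊏ (x ∷ʳ j) → length z ≡ length x → z ≡ x
  ⊏-∷ʳ-sameLength [] [] j a e = refl
  ⊏-∷ʳ-sameLength (i ∷ z) (.i ∷ x) j (anc-there a) e = cong (i ∷_) (⊏-∷ʳ-sameLength z x j a (suc-injective e))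

  ≺-irrefl : ∀ p → ¬ p ≺ p
  ≺-irrefl (i ∷ p) (left-here i<i) = <-irrefl refl i<i
  ≺-irrefl (i ∷ p) (left-there l) = ≺-irrefl p l

  ≺-asym : ∀ {p q} → p ≺ q → ¬ q ≺ p
  ≺-asym (left-here i<j) (left-here j<i) = <-asym i<j j<i
  ≺-asym (left-here i<i) (left-there _) = <-irrefl refl i<i
  ≺-asym (left-there _) (left-here i<i) = <-irrefl refl i<i
  ≺-asym (left-there l) (left-there l′) = ≺-asym l l′

  ≺-trans : ∀ {x y z} → x ≺ y → y ≺ z → x ≺ z
  ≺-trans (left-here i<j) (left-here j<k) = left-here (<-trans i<j j<k)
  ≺-trans (left-here i<j) (left-there _) = left-here i<j
  ≺-trans (left-there _) (left-here j<k) = left-here j<k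
  ≺-trans (left-there l) (left-there l′) = left-there (≺-trans l l′)

  _≺?_ : ∀ p q → Dec (p ≺ q)
  [] ≺? q = no λ ()
  (i ∷ p) ≺? [] = no λ ()
  (i ∷ p) ≺? (j ∷ q) with i <? j | i ≟ j | p ≺? q
  ... | yes i<j | _ | _ = yes (left-here i<j)
  ... | no i≮j | no i≢j | _ = no λ { (left-here i<j) → i≮j i<j ; (left-there _) → i≢j refl }
  ... | no i≮j | yes refl | yes l = yes (left-there l)
  ... | no i≮j | yes refl | no ¬l = no λ { (left-here i<j) → i≮j i<j ; (left-there l) → ¬l l }

  ≺-tail : ∀ {i p q} → (i ∷ p) ≺ (i ∷ q) → p ≺ q
  ≺-tail (left-here i<i) = ⊥-elim (<-irrefl refl i<i)
  ≺-tail (left-there l) = l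

  ≺-suc : ∀ {i j p q} → (i ∷ p) ≺ (j ∷ q) → (suc i ∷ p) ≺ (suc j ∷ q)
  ≺-suc (left-here i<j) = left-here (s≤s i<j)
  ≺-suc (left-there l) = left-there l

  ≺-suc⁻ : ∀ {i j p q} → (suc i ∷ p) ≺ (suc j ∷ q) → (i ∷ p) ≺ (j ∷ q)
  ≺-suc⁻ (left-here i<j) = left-here (s≤s⁻¹ i<j)
  ≺-suc⁻ (left-there l) = left-there l

  ≺-∷ʳ⁺ : ∀ {z x} j → z ≺ x → z ≺ (x ∷ʳ j)
  ≺-∷ʳ⁺ j (left-here i<k) = left-here i<k
  ≺-∷ʳ⁺ j (left-there l) = left-there (≺-∷ʳ⁺ j l)

  ≺-∷ʳ⁻ : ∀ z x j → z ≺ (x ∷ʳ j) → length z ≡ length x → z ≺ x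
  ≺-∷ʳ⁻ (i ∷ z) (k ∷ x) j (left-here i<k) e = left-here i<k
  ≺-∷ʳ⁻ (i ∷ z) (k ∷ x) j (left-there l) e = left-there (≺-∷ʳ⁻ z x j l (suc-injective e))
  ≺-∷ʳ⁻ (i ∷ z) [] j l ()

  ≺-⊏ : ∀ {y z x} → y ≺ z → z ⊏ x → y ≺ x
  ≺-⊏ (left-here i<j) (anc-there _) = left-here i<j
  ≺-⊏ (left-there l) (anc-there a) = left-there (≺-⊏ l a)

  ⊏-≺ : ∀ {y z x} → y ⊏ z → z ≺ x → (y ⊏ x) ⊎ (y ≺ x)
  ⊏-≺ {x = k ∷ x} anc-here l = inj₁ anc-here
  ⊏-≺ (anc-there a) (left-here i<k) = inj₂ (left-here i<k)
  ⊏-≺ (anc-there a) (left-there l) with ⊏-≺ a l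
  ... | inj₁ a′ = inj₁ (anc-there a′)
  ... | inj₂ l′ = inj₂ (left-there l′)

  ⊏-≺-⊥ : ∀ {x y} → x ⊏ y → ¬ y ≺ x
  ⊏-≺-⊥ (anc-there a) (left-here i<i) = <-irrefl refl i<i
  ⊏-≺-⊥ (anc-there a) (left-there l) = ⊏-≺-⊥ a l

  ◁R-trans : ∀ {x y z} → _◁R_ {N} x y → _◁R_ {N} y z → _◁R_ {N} x z
  ◁R-trans (inj₁ a) (inj₁ b) = inj₁ (⊏-trans b a)
  ◁R-trans (inj₁ a) (inj₂ l) = inj₂ (≺-⊏ l a)
  ◁R-trans (inj₂ l) (inj₁ b) = ⊏-≺ b l
  ◁R-trans (inj₂ l) (inj₂ l′) = inj₂ (≺-trans l′ l)

  ≺-connex : ∀ p q → length p ≡ length q → ¬ p ≺ q → ¬ q ≺ p → p ≡ q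
  ≺-connex [] [] e _ _ = refl
  ≺-connex (i ∷ p) (j ∷ q) e p⊀q q⊀p with <-cmp i j
  ... | tri< i<j _ _ = ⊥-elim (p⊀q (left-here i<j))
  ... | tri> _ _ j<i = ⊥-elim (q⊀p (left-here j<i))
  ... | tri≈ _ refl _ = cong (i ∷_) (≺-connex p q (suc-injective e) (p⊀q ∘ left-there) (q⊀p ∘ left-there))

  Has : Maybe (Tree N) → (Tree N → Set) → Set
  Has m P = Σ (Tree N) λ s → (m ≡ just s) × P s

  IsLeafNode IsUnary IsNonDeg UnaryOverNonDeg : Tree N → Set
  IsLeafNode s = kids s ≡ []
  IsUnary s = length (kids s) ≡ 1
  IsNonDeg s = 2 ≤ length (kids s)
  UnaryOverNonDeg s = Σ (Tree N) λ c → (kids s ≡ c ∷ []) × IsNonDeg c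

  forestAt : List (Tree N) → ℕ → List ℕ → Maybe (Tree N)
  forestAt [] i p = nothing
  forestAt (t ∷ ts) zero p = t at p
  forestAt (t ∷ ts) (suc i) p = forestAt ts i p

  at-node : ∀ c ts i p → node c ts at (i ∷ p) ≡ forestAt ts i p
  at-node c [] i p = refl
  at-node c (t ∷ ts) zero p = refl
  at-node c (t ∷ ts) (suc i) p = trans (shift ts) (at-node c ts i p)
    where
    shift : ∀ ts → node c (t ∷ ts) at (suc i ∷ p) ≡ node c ts at (i ∷ p)
    shift ts with nth ts i
    ... | nothing = refl
    ... | just s = refl

  at-∷ : ∀ (t : Tree N) i p {s} → t at (i ∷ p) ≡ just s →
    Σ (Tree N) λ s₁ → (nth (kids t) i ≡ just s₁) × (s₁ at p ≡ just s)
  at-∷ (node c ts) i p e with nth ts i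
  ... | just s₁ = s₁ , refl , e

  at-∷⁻ : ∀ (t : Tree N) i p {s₁} → nth (kids t) i ≡ just s₁ → t at (i ∷ p) ≡ s₁ at p
  at-∷⁻ (node c ts) i p e with nth ts i
  at-∷⁻ (node c ts) i p refl | just _ = refl

  at-∷ʳ : ∀ (t : Tree N) x j {s} → t at (x ∷ʳ j) ≡ just s →
    Σ (Tree N) λ s′ → (t at x ≡ just s′) × (nth (kids s′) j ≡ just s)
  at-∷ʳ t [] j e with at-∷ t j [] e
  ... | _ , e₁ , refl = t , refl , e₁
  at-∷ʳ t (i ∷ x) j e with at-∷ t i (x ∷ʳ j) e
  ... | s₁ , e₁ , e₂ with at-∷ʳ s₁ x j e₂
  ... | s′ , e₃ , e₄ = s′ , trans (at-∷⁻ t i x e₁) e₃ , e₄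

  at-∷ʳ⁻ : ∀ (t : Tree N) x j {s′ s} → t at x ≡ just s′ → nth (kids s′) j ≡ just s →
    t at (x ∷ʳ j) ≡ just s
  at-∷ʳ⁻ t [] j refl e = at-∷⁻ t j [] e
  at-∷ʳ⁻ t (i ∷ x) j e₁ e₂ with at-∷ t i x e₁
  ... | s₁ , e₃ , e₄ = trans (at-∷⁻ t i (x ∷ʳ j) e₃) (at-∷ʳ⁻ s₁ x j e₄ e₂)

  parent-of-nonDeg : ∀ (t : Tree N) x j → Has (t at (x ∷ʳ j)) IsNonDeg →
    Has (t at x) UnaryOverNonDeg ⊎ Has (t at x) IsNonDeg
  parent-of-nonDeg t x j (s , e , nd) with at-∷ʳ t x j e
  ... | node c (s₁ ∷ []) , e′ , en with j | en
  ...   | zero | refl = inj₁ (node c (s ∷ []) , e′ , s , refl , nd)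
  parent-of-nonDeg t x j (s , e , nd) | node c (_ ∷ _ ∷ _) , e′ , _ = inj₂ (_ , e′ , s≤s (s≤s z≤n))

  child-of-unaryOverNonDeg : ∀ (t : Tree N) x → Has (t at x) UnaryOverNonDeg → Has (t at (x ∷ʳ 0)) IsNonDeg
  child-of-unaryOverNonDeg t x (node _ (c ∷ []) , e , .c , refl , nd) = c , at-∷ʳ⁻ t x 0 e refl , nd

  data RootedVertex (c : Fin N) (ts : List (Tree N)) (P : Tree N → Set) : ℕ → List ℕ → Set where
    root  : P (node c ts) → RootedVertex c ts P 0 []
    below : ∀ {j p} → Has (forestAt ts j p) P → RootedVertex c ts P 0 (j ∷ p)

  rootedVertex : ∀ {c ts P} i p → Has (forestAt (node c ts ∷ []) i p) P → RootedVertex c ts P i p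
  rootedVertex zero [] (_ , refl , Ps) = root Ps
  rootedVertex {c} {ts} zero (j ∷ p) h = below (subst (λ m → Has m _) (at-node c ts j p) h)

  below⁻ : ∀ {P} c ts j p → Has (forestAt ts j p) P → Has (forestAt (node c ts ∷ []) 0 (j ∷ p)) P
  below⁻ c ts j p = subst (λ m → Has m _) (sym (at-node c ts j p))

  LevelOccupied : List (Tree N) → ℕ → Set
  LevelOccupied ts l = Σ ℕ λ i → Σ (List ℕ) λ p → (length p ≡ l) × Has (forestAt ts i p) IsNonDeg

  -- The shape of the forest of subtrees below a vertex of a proper layered simple
  -- order-reduced tree, with the forest's roots at depth 0 and (i , p) the vertex at path
  -- p of the i-th tree; ordered is order reducedness in forest form.
  record SimpleForest (a n h : ℕ) (ts : List (Tree N)) : Set where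
    field
      leaf-depth : ∀ i p → Has (forestAt ts i p) IsLeafNode → length p ≡ h
      occupied   : ∀ k → k < n → LevelOccupied ts (a + k)
      confined   : ∀ i p → Has (forestAt ts i p) IsNonDeg → (a ≤ length p) × (length p < a + n)
      simple     : ∀ i p j q → Has (forestAt ts i p) IsNonDeg → Has (forestAt ts j q) IsNonDeg →
                   length p ≡ length q → (i ≡ j) × (p ≡ q)
      ordered    : ∀ i x j q → Has (forestAt ts i x) UnaryOverNonDeg → Has (forestAt ts j q) IsNonDeg →
                   length q ≡ length x → (j ∷ q) ≺ (i ∷ x)
      coloured   : ColoredL ts

  open SimpleForest

  Colored-kids : ∀ {c} {ts : List (Tree N)} → Colored (node c ts) → ColoredL ts
  Colored-kids {ts = []} _ = tt
  Colored-kids {ts = _ ∷ []} (_ , ct) = ct , tt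
  Colored-kids {ts = _ ∷ _ ∷ _} cts = cts

  emptySF : ∀ {a h} → SimpleForest a 0 h []
  leaf-depth emptySF i p (_ , () , _)
  occupied emptySF k ()
  confined emptySF i p (_ , () , _)
  simple emptySF i p j q (_ , () , _) _ _
  ordered emptySF i x j q (_ , () , _) _ _
  coloured emptySF = tt

  leafSF : ∀ c → SimpleForest 0 0 0 (node c [] ∷ [])
  leaf-depth (leafSF c) i p h with rootedVertex i p h
  ... | root _ = refl
  ... | below (_ , () , _)
  occupied (leafSF c) k ()
  confined (leafSF c) i p h with rootedVertex i p h
  ... | below (_ , () , _)
  simple (leafSF c) i p j q h _ _ with rootedVertex i p h
  ... | below (_ , () , _)
  ordered (leafSF c) i x j q u _ _ with rootedVertex i x u
  ... | root (_ , () , _)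
  ... | below (_ , () , _)
  coloured (leafSF c) = tt , tt

  unarySF : ∀ {a n h c} {X : Tree N} → colour X ≡ c → SimpleForest a n h (X ∷ []) →
    SimpleForest (suc a) n (suc h) (node c (X ∷ []) ∷ [])
  leaf-depth (unarySF e f) i p h with rootedVertex i p h
  ... | below {j} {p′} h′ = cong suc (leaf-depth f j p′ h′)
  occupied (unarySF {c = c} {X} e f) k k<n with occupied f k k<n
  ... | i , p , lp , h = 0 , i ∷ p , cong suc lp , below⁻ c (X ∷ []) i p h
  confined (unarySF e f) i p h with rootedVertex i p h
  ... | root (s≤s ())
  ... | below {j} {p′} h′ = map× s≤s s≤s (confined f j p′ h′)
  simple (unarySF e f) i p j q h h′ lp with rootedVertex i p h | rootedVertex j q h′
  ... | root (s≤s ()) | _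
  ... | below _ | root (s≤s ())
  ... | below {j₁} {p₁} g | below {j₂} {q₂} g′ with simple f j₁ p₁ j₂ q₂ g g′ (suc-injective lp)
  ...   | refl , refl = refl , refl
  ordered (unarySF e f) i x j q u h lq with rootedVertex i x u | rootedVertex j q h
  ... | _ | root (s≤s ())
  ... | root _ | below _ = ⊥-elim (1+n≢0 lq)
  ... | below {j₁} {x₁} g | below {j₂} {q₂} g′ = left-there (ordered f j₁ x₁ j₂ q₂ g g′ (suc-injective lq))
  coloured (unarySF e f) = (e , proj₁ (coloured f)) , tt

  nonDegSF : ∀ {n h c} {x y : Tree N} {r} → SimpleForest 0 n h (x ∷ y ∷ r) →
    SimpleForest 0 (suc n) (suc h) (node c (x ∷ y ∷ r) ∷ [])
  leaf-depth (nonDegSF f) i p h with rootedVertex i p h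
  ... | below {j} {p′} h′ = cong suc (leaf-depth f j p′ h′)
  occupied (nonDegSF f) zero _ = 0 , [] , refl , _ , refl , s≤s (s≤s z≤n)
  occupied (nonDegSF {c = c} {x} {y} {r} f) (suc k) (s≤s k<n) with occupied f k k<n
  ... | i , p , lp , h = 0 , i ∷ p , cong suc lp , below⁻ c (x ∷ y ∷ r) i p h
  confined (nonDegSF f) i p h with rootedVertex i p h
  ... | root _ = z≤n , s≤s z≤n
  ... | below {j} {p′} h′ = z≤n , s≤s (proj₂ (confined f j p′ h′))
  simple (nonDegSF f) i p j q h h′ lp with rootedVertex i p h | rootedVertex j q h′
  ... | root _ | root _ = refl , refl
  ... | root _ | below _ = ⊥-elim (0≢1+n lp)
  ... | below _ | root _ = ⊥-elim (1+n≢0 lp)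
  ... | below {j₁} {p₁} g | below {j₂} {q₂} g′ with simple f j₁ p₁ j₂ q₂ g g′ (suc-injective lp)
  ...   | refl , refl = refl , refl
  ordered (nonDegSF f) i x j q u h lq with rootedVertex i x u | rootedVertex j q h
  ... | root (_ , () , _) | _
  ... | below _ | root _ = ⊥-elim (0≢1+n lq)
  ... | below {j₁} {x₁} g | below {j₂} {q₂} g′ = left-there (ordered f j₁ x₁ j₂ q₂ g g′ (suc-injective lq))
  coloured (nonDegSF f) = coloured f , tt

  unaryChildSF : ∀ {a n h c} {X : Tree N} → SimpleForest (suc a) n (suc h) (node c (X ∷ []) ∷ []) →
    SimpleForest a n h (X ∷ [])
  leaf-depth (unaryChildSF {c = c} {X} f) i p h = suc-injective (leaf-depth f 0 (i ∷ p) (below⁻ c (X ∷ []) i p h))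
  occupied (unaryChildSF f) k k<n with occupied f k k<n
  ... | i , p , lp , h with rootedVertex i p h
  ...   | root (s≤s ())
  ...   | below {j} {p′} h′ = j , p′ , suc-injective lp , h′
  confined (unaryChildSF {c = c} {X} f) i p h =
    map× s≤s⁻¹ s≤s⁻¹ (confined f 0 (i ∷ p) (below⁻ c (X ∷ []) i p h))
  simple (unaryChildSF {c = c} {X} f) i p j q h h′ lp =
    ∷-injective (proj₂ (simple f 0 (i ∷ p) 0 (j ∷ q)
      (below⁻ c (X ∷ []) i p h) (below⁻ c (X ∷ []) j q h′) (cong suc lp)))
  ordered (unaryChildSF {c = c} {X} f) i x j q u h lq =
    ≺-tail (ordered f 0 (i ∷ x) 0 (j ∷ q) (below⁻ c (X ∷ []) i x u) (below⁻ c (X ∷ []) j q h) (cong suc lq))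
  coloured (unaryChildSF {X = X} f) = Colored-kids {ts = X ∷ []} (proj₁ (coloured f))

  nonDegChildrenSF : ∀ {n h c} {ts : List (Tree N)} → SimpleForest 0 (suc n) (suc h) (node c ts ∷ []) →
    SimpleForest 0 n h ts
  leaf-depth (nonDegChildrenSF {c = c} {ts} f) i p h = suc-injective (leaf-depth f 0 (i ∷ p) (below⁻ c ts i p h))
  occupied (nonDegChildrenSF f) k k<n with occupied f (suc k) (s≤s k<n)
  ... | i , p , lp , h with rootedVertex i p h
  ...   | below {j} {p′} h′ = j , p′ , suc-injective lp , h′
  confined (nonDegChildrenSF {c = c} {ts} f) i p h = z≤n , s≤s⁻¹ (proj₂ (confined f 0 (i ∷ p) (below⁻ c ts i p h)))
  simple (nonDegChildrenSF {c = c} {ts} f) i p j q h h′ lp =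
    ∷-injective (proj₂ (simple f 0 (i ∷ p) 0 (j ∷ q) (below⁻ c ts i p h) (below⁻ c ts j q h′) (cong suc lp)))
  ordered (nonDegChildrenSF {c = c} {ts} f) i x j q u h lq =
    ≺-tail (ordered f 0 (i ∷ x) 0 (j ∷ q) (below⁻ c ts i x u) (below⁻ c ts j q h) (cong suc lq))
  coloured (nonDegChildrenSF f) = Colored-kids (proj₁ (coloured f))

  mergeSF : ∀ {a m₁ m₂ h} {t : Tree N} {ts} → SimpleForest a m₁ h (t ∷ []) → SimpleForest (a + m₁) m₂ h ts →
    SimpleForest a (m₁ + m₂) h (t ∷ ts)
  leaf-depth (mergeSF f g) zero p lf = leaf-depth f 0 p lf
  leaf-depth (mergeSF f g) (suc i) p lf = leaf-depth g i p lf
  occupied (mergeSF {m₁ = m₁} f g) k k<m with k <? m₁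
  ... | yes k<m₁ with occupied f k k<m₁
  ...   | zero , p , lp , nd = 0 , p , lp , nd
  occupied (mergeSF {a} {m₁} f g) k k<m | no k≮m₁ with occupied g (k ∸ m₁) (m≤n⇒n<m+o⇒n∸m<o (≮⇒≥ k≮m₁) k<m)
  ... | i , p , lp , nd =
    suc i , p , trans lp (trans (+-assoc a m₁ (k ∸ m₁)) (cong (a +_) (m+[n∸m]≡n (≮⇒≥ k≮m₁)))) , nd
  confined (mergeSF {a} {m₁} {m₂} f g) zero p nd with confined f 0 p nd
  ... | a≤ , lt = a≤ , <-≤-trans lt (+-monoʳ-≤ a (m≤m+n m₁ m₂))
  confined (mergeSF {a} {m₁} {m₂} f g) (suc i) p nd with confined g i p nd
  ... | a≤ , lt = ≤-trans (m≤m+n a m₁) a≤ , subst (length p <_) (+-assoc a m₁ m₂) lt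
  simple (mergeSF f g) zero p zero q nd nd′ e = simple f 0 p 0 q nd nd′ e
  simple (mergeSF f g) (suc i) p (suc j) q nd nd′ e = map₁ (cong suc) (simple g i p j q nd nd′ e)
  simple (mergeSF f g) zero p (suc j) q nd nd′ e =
    ⊥-elim (<⇒≱ (proj₂ (confined f 0 p nd)) (subst (_ ≤_) (sym e) (proj₁ (confined g j q nd′))))
  simple (mergeSF f g) (suc i) p zero q nd nd′ e =
    ⊥-elim (<⇒≱ (proj₂ (confined f 0 q nd′)) (subst (_ ≤_) e (proj₁ (confined g i p nd))))
  ordered (mergeSF f g) zero x zero q u nd e = ordered f 0 x 0 q u nd e
  ordered (mergeSF f g) (suc i) x (suc j) q u nd e = ≺-suc (ordered g i x j q u nd e)
  ordered (mergeSF f g) (suc i) x zero q u nd e = left-here (s≤s z≤n)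
  ordered (mergeSF {t = t} f g) zero x (suc j) q u nd e =
    ⊥-elim (<⇒≱ child-above-tail (m≤n⇒m≤1+n (subst (_ ≤_) e (proj₁ (confined g j q nd)))))
    where
    child-above-tail : suc (length x) < _
    child-above-tail = subst (_< _) (length-∷ʳ x 0) (proj₂ (confined f 0 (x ∷ʳ 0) (child-of-unaryOverNonDeg t x u)))
  coloured (mergeSF f g) = proj₁ (coloured f) , coloured g

  nonDeg-parent : ∀ (t : Tree N) p {l} → Has (t at p) IsNonDeg → length p ≡ suc l →
    Σ (List ℕ) λ x → (length x ≡ l) × (Has (t at x) UnaryOverNonDeg ⊎ Has (t at x) IsNonDeg)
  nonDeg-parent t p nd lp with initLast p
  ... | x ∷ʳ′ j = x , suc-injective (trans (sym (length-∷ʳ x j)) lp) , parent-of-nonDeg t x j nd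

  module Split {a n h} {t : Tree N} {ts} (f : SimpleForest a n h (t ∷ ts)) where

    tail-occupied? : ∀ k → k < n → Dec (LevelOccupied ts (a + k))
    tail-occupied? k k<n with occupied f k k<n
    ... | suc i , p , lp , nd = yes (i , p , lp , nd)
    ... | zero , p , lp , nd =
      no λ (i , q , lq , nd′) → 0≢1+n (proj₁ (simple f 0 p (suc i) q nd nd′ (trans lp (sym lq))))

    tail-occupied-upward : ∀ k → suc k < n → LevelOccupied ts (a + k) → LevelOccupied ts (a + suc k)
    tail-occupied-upward k sk<n (i , q , lq , nd-q) with occupied f (suc k) sk<n
    ... | suc i′ , p , lp , nd = i′ , p , lp , nd
    ... | zero , p , lp , nd with nonDeg-parent t p nd (trans lp (+-suc a k))
    ...   | x , lx , inj₁ u = ⊥-elim (head-not-right (ordered f 0 x (suc i) q u nd-q (trans lq (sym lx))))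
      where
      head-not-right : ¬ (suc i ∷ q) ≺ (0 ∷ x)
      head-not-right (left-here ())
    ...   | x , lx , inj₂ nd-x = ⊥-elim (0≢1+n (proj₁ (simple f 0 x (suc i) q nd-x nd-q (trans lx (sym lq)))))

    module _ {m} (m≤n : m ≤ n) (before : ∀ k → k < m → ¬ LevelOccupied ts (a + k))
             (after : ∀ k → m ≤ k → k < n → LevelOccupied ts (a + k)) where

      headSF : SimpleForest a m h (t ∷ [])
      leaf-depth headSF zero p lf = leaf-depth f 0 p lf
      occupied headSF k k<m with occupied f k (<-≤-trans k<m m≤n)
      ... | zero , p , lp , nd = 0 , p , lp , nd
      ... | suc i , p , lp , nd = ⊥-elim (before k k<m (i , p , lp , nd))
      confined headSF zero p nd with confined f 0 p nd
      ... | a≤ , lt with length p <? a + m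
      ...   | yes l = a≤ , l
      ...   | no l≮ with after (length p ∸ a) (+-cancelˡ-≤ a m (length p ∸ a) a+m≤) (m≤n⇒n<m+o⇒n∸m<o a≤ lt)
        where
        a+m≤ : a + m ≤ a + (length p ∸ a)
        a+m≤ = subst (a + m ≤_) (sym (m+[n∸m]≡n a≤)) (≮⇒≥ l≮)
      ...     | i , q , lq , nd′ =
        ⊥-elim (0≢1+n (proj₁ (simple f 0 p (suc i) q nd nd′ (sym (trans lq (m+[n∸m]≡n a≤))))))
      simple headSF zero p zero q nd nd′ e = simple f 0 p 0 q nd nd′ e
      ordered headSF zero x zero q u nd e = ordered f 0 x 0 q u nd e
      coloured headSF = proj₁ (coloured f) , tt

      tailSF : SimpleForest (a + m) (n ∸ m) h ts
      leaf-depth tailSF i p lf = leaf-depth f (suc i) p lf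
      occupied tailSF k k<n-m with after (m + k) (m≤m+n m k) (subst (m + k <_) (m+[n∸m]≡n m≤n) (+-monoʳ-< m k<n-m))
      ... | i , p , lp , nd = i , p , trans lp (sym (+-assoc a m k)) , nd
      confined tailSF i p nd with confined f (suc i) p nd
      ... | a≤ , lt with a + m ≤? length p
      ...   | yes l = l , subst (length p <_) (sym (trans (+-assoc a m (n ∸ m)) (cong (a +_) (m+[n∸m]≡n m≤n)))) lt
      ...   | no l≰ =
        ⊥-elim (before (length p ∸ a) (m≤n⇒n<m+o⇒n∸m<o a≤ (≰⇒> l≰)) (i , p , sym (m+[n∸m]≡n a≤) , nd))
      simple tailSF i p j q nd nd′ e = map₁ suc-injective (simple f (suc i) p (suc j) q nd nd′ e)
      ordered tailSF i x j q u nd e = ≺-suc⁻ (ordered f (suc i) x (suc j) q u nd e)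
      coloured tailSF = proj₂ (coloured f)

    splitSF : Σ ℕ λ m₁ → Σ ℕ λ m₂ →
      (m₁ + m₂ ≡ n) × SimpleForest a m₁ h (t ∷ []) × SimpleForest (a + m₁) m₂ h ts
    splitSF with upward-closed-threshold n (λ k → LevelOccupied ts (a + k)) tail-occupied? tail-occupied-upward
    ... | m , m≤n , before , after = m , n ∸ m , m+[n∸m]≡n m≤n , headSF m≤n before after , tailSF m≤n before after

  open Split using (splitSF)

  pad : Fin N → ℕ → Tree N → Tree N
  pad c zero X = X
  pad c (suc k) X = node c (pad c k X ∷ [])

  -- spread o t lays out the non-leaf vertices of a reduced tree t one per level, the root
  -- first and then the subtrees of the children from left to right, so that all leaves lie
  -- o levels below the last of them; in spreadL a o ts the first tree starts a levels down.
  spread : ℕ → Tree N → Tree N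
  spreadL : ℕ → ℕ → List (Tree N) → List (Tree N)
  spread o (node c []) = pad c o (node c [])
  spread o (node c (t ∷ ts)) = node c (spreadL 0 o (t ∷ ts))
  spreadL a o [] = []
  spreadL a o (t ∷ ts) = pad (colour t) a (spread (o + nonLeafCountL ts) t) ∷ spreadL (a + nonLeafCount t) o ts

  ReducedTree : Tree N → Set
  ReducedForest : List (Tree N) → Set
  ReducedTree (node c []) = ⊤
  ReducedTree (node c (_ ∷ [])) = ⊥
  ReducedTree (node c ts@(_ ∷ _ ∷ _)) = ReducedForest ts
  ReducedForest [] = ⊤
  ReducedForest (t ∷ ts) = ReducedTree t × ReducedForest ts

  colour-pad : ∀ c k (X : Tree N) → colour X ≡ c → colour (pad c k X) ≡ c
  colour-pad c zero X e = e
  colour-pad c (suc k) X e = refl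

  colour-spread : ∀ o (t : Tree N) → colour (spread o t) ≡ colour t
  colour-spread o (node c []) = colour-pad c o (node c []) refl
  colour-spread o (node c (_ ∷ _)) = refl

  ρ-pad : ∀ c k (X : Tree N) → ρ (pad c k X) ≡ ρ X
  ρ-pad c zero X = refl
  ρ-pad c (suc k) X = ρ-pad c k X

  ρ-spread : ∀ o (t : Tree N) → ReducedTree t → ρ (spread o t) ≡ t
  ρL-spreadL : ∀ a o (ts : List (Tree N)) → ReducedForest ts → ρL (spreadL a o ts) ≡ ts
  ρ-spread o (node c []) _ = ρ-pad c o (node c [])
  ρ-spread o (node c ts@(_ ∷ _ ∷ _)) red = cong (node c) (ρL-spreadL 0 o ts red)
  ρL-spreadL a o [] _ = refl
  ρL-spreadL a o (t ∷ ts) (red-t , red-ts) =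
    cong₂ _∷_ (trans (ρ-pad (colour t) a _) (ρ-spread _ t red-t)) (ρL-spreadL _ o ts red-ts)

  shiftEmptySF : ∀ {a a′ h} {ts : List (Tree N)} → SimpleForest a 0 h ts → SimpleForest a′ 0 h ts
  leaf-depth (shiftEmptySF f) = leaf-depth f
  occupied (shiftEmptySF f) k ()
  confined (shiftEmptySF {a} f) i p nd with confined f i p nd
  ... | a≤ , lt = ⊥-elim (<⇒≱ lt (subst (_≤ length p) (sym (+-identityʳ a)) a≤))
  simple (shiftEmptySF f) = simple f
  ordered (shiftEmptySF f) = ordered f
  coloured (shiftEmptySF f) = coloured f

  padSF : ∀ k {a n h c} {X : Tree N} → colour X ≡ c → SimpleForest a n h (X ∷ []) →
    SimpleForest (k + a) n (k + h) (pad c k X ∷ [])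
  padSF zero e f = f
  padSF (suc k) {c = c} {X} e f = unarySF (colour-pad c k X e) (padSF k e f)


  spreadSF : ∀ (t : Tree N) o → ReducedTree t → SimpleForest 0 (nonLeafCount t) (nonLeafCount t + o) (spread o t ∷ [])
  spreadLSF : ∀ (ts : List (Tree N)) a o → ReducedForest ts →
    SimpleForest a (nonLeafCountL ts) (a + nonLeafCountL ts + o) (spreadL a o ts)
  spreadSF (node c []) o _ =
    shiftEmptySF (subst (λ h → SimpleForest (o + 0) 0 h (spread o (node c []) ∷ [])) (+-identityʳ o)
                        (padSF o refl (leafSF c)))
  spreadSF (node c ts@(_ ∷ _ ∷ _)) o red = nonDegSF (spreadLSF ts 0 o red)
  spreadLSF [] a o _ = emptySF
  spreadLSF (t ∷ ts) a o (red-t , red-ts) =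
    mergeSF head (subst (λ h → SimpleForest (a + m₁) m₂ h (spreadL (a + m₁) o ts)) (sym (a+[m+n]+o≡a+m+n+o a m₁ m₂ o)) tail)
    where
    m₁ = nonLeafCount t
    m₂ = nonLeafCountL ts
    head : SimpleForest a m₁ (a + (m₁ + m₂) + o) (pad (colour t) a (spread (o + m₂) t) ∷ [])
    head = subst₂ (λ a′ h → SimpleForest a′ m₁ h (pad (colour t) a (spread (o + m₂) t) ∷ []))
             (+-identityʳ a) (trans (sym (+-assoc a _ _)) (sym (a+[m+n]+o≡a+m+[o+n] a m₁ m₂ o)))
             (padSF a (colour-spread (o + m₂) t) (spreadSF t (o + m₂) red-t))
    tail : SimpleForest (a + m₁) m₂ (a + m₁ + m₂ + o) (spreadL (a + m₁) o ts)
    tail = spreadLSF ts (a + m₁) o red-ts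

  colour-ρ : ∀ (t : Tree N) → Colored t → colour (ρ t) ≡ colour t
  colour-ρ (node c []) _ = refl
  colour-ρ (node c (x ∷ [])) (e , cx) = trans (colour-ρ x cx) e
  colour-ρ (node c (_ ∷ _ ∷ _)) _ = refl

  deepestLeaf : ∀ (t : Tree N) → Σ (List ℕ) λ p → Has (t at p) IsLeafNode × (length p ≡ height t)
  deepestLeafL : ∀ (x : Tree N) xs →
    Σ ℕ λ i → Σ (List ℕ) λ p → Has (forestAt (x ∷ xs) i p) IsLeafNode × (length p ≡ heightL (x ∷ xs))
  deepestLeaf (node c []) = [] , (node c [] , refl , refl) , refl
  deepestLeaf (node c (x ∷ xs)) with deepestLeafL x xs
  ... | i , p , h , e = i ∷ p , below⁻ c (x ∷ xs) i p h , cong suc e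
  deepestLeafL x [] with deepestLeaf x
  ... | p , h , e = 0 , p , h , trans e (sym (⊔-identityʳ _))
  deepestLeafL x (y ∷ ys) with height x ≤? heightL (y ∷ ys)
  ... | yes x≤ys = let (i , p , h , e) = deepestLeafL y ys in suc i , p , h , trans e (sym (m≤n⇒m⊔n≡n x≤ys))
  ... | no x≰ys = let (p , h , e) = deepestLeaf x in 0 , p , h , trans e (sym (m≥n⇒m⊔n≡m (≰⇒≥ x≰ys)))

  height-SF : ∀ {a n h} {t : Tree N} → SimpleForest a n h (t ∷ []) → height t ≡ h
  height-SF {t = t} f = let (p , h , e) = deepestLeaf t in trans (sym e) (leaf-depth f 0 p h)

  root-occupied : ∀ {n h} {t : Tree N} → SimpleForest 0 (suc n) h (t ∷ []) → IsNonDeg t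
  root-occupied f with occupied f 0 (s≤s z≤n)
  ... | zero , [] , _ , (_ , refl , nd) = nd

  root-unoccupied : ∀ {a n h} {t : Tree N} → SimpleForest (suc a) n h (t ∷ []) → ¬ IsNonDeg t
  root-unoccupied {t = t} f nd with confined f 0 [] (t , refl , nd)
  ... | () , _

  SF₀⇒chain : ∀ h (t : Tree N) → SimpleForest 0 0 h (t ∷ []) → t ≡ pad (colour t) h (node (colour t) [])
  SF₀⇒chain zero (node c []) f = refl
  SF₀⇒chain zero (node c (_ ∷ _)) f = ⊥-elim (1+n≢0 (height-SF f))
  SF₀⇒chain (suc h) (node c []) f = ⊥-elim (0≢1+n (height-SF f))
  SF₀⇒chain (suc h) (node c (x ∷ [])) f =
    cong (λ x′ → node c (x′ ∷ []))
      (trans (SF₀⇒chain h x (unaryChildSF (shiftEmptySF f)))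
             (cong (λ c′ → pad c′ h (node c′ [])) (proj₁ (proj₁ (coloured f)))))
  SF₀⇒chain (suc h) (node c (_ ∷ _ ∷ _)) f with confined f 0 [] (_ , refl , s≤s (s≤s z≤n))
  ... | _ , ()

  ∷-spreadL : ∀ (t : Tree N) ts a o {m₁ m₂} → colour (ρ t) ≡ colour t →
    m₁ ≡ nonLeafCount (ρ t) → m₂ ≡ nonLeafCountL (ρL ts) →
    t ≡ pad (colour t) a (spread (o + m₂) (ρ t)) → ts ≡ spreadL (a + m₁) o (ρL ts) →
    t ∷ ts ≡ spreadL a o (ρL (t ∷ ts))
  ∷-spreadL t ts a o ρt-colour refl refl t≡ ts≡ rewrite ρt-colour = cong₂ _∷_ t≡ ts≡

  unique-tree : ∀ (t : Tree N) a n o → SimpleForest a n (a + n + o) (t ∷ []) →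
    (n ≡ nonLeafCount (ρ t)) × (t ≡ pad (colour t) a (spread o (ρ t)))
  unique-forest : ∀ (ts : List (Tree N)) a n o → SimpleForest a n (a + n + o) ts →
    (n ≡ nonLeafCountL (ρL ts)) × (ts ≡ spreadL a o (ρL ts))
  unique-tree t zero zero o f rewrite SF₀⇒chain o t f | ρ-pad (colour t) o (node (colour t) []) = refl , refl
  unique-tree (node c []) zero (suc n) o f with root-occupied f
  ... | ()
  unique-tree (node c (_ ∷ [])) zero (suc n) o f with root-occupied f
  ... | s≤s ()
  unique-tree (node c ts@(_ ∷ _ ∷ _)) zero (suc n) o f with unique-forest ts 0 n o (nonDegChildrenSF f)
  ... | e₁ , e₂ = cong suc e₁ , cong (node c) e₂
  unique-tree (node c []) (suc a) n o f = ⊥-elim (0≢1+n (height-SF f))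
  unique-tree (node c (x ∷ [])) (suc a) n o f with unique-tree x a n o (unaryChildSF f)
  ... | e₁ , e₂ =
    e₁ , cong (λ x′ → node c (x′ ∷ [])) (trans e₂ (cong (λ c′ → pad c′ a (spread o (ρ x))) (proj₁ (proj₁ (coloured f)))))
  unique-tree (node c (_ ∷ _ ∷ _)) (suc a) n o f = ⊥-elim (root-unoccupied f (s≤s (s≤s z≤n)))
  unique-forest [] a zero o f = refl , refl
  unique-forest [] a (suc n) o f with occupied f 0 (s≤s z≤n)
  ... | _ , _ , _ , (_ , () , _)
  unique-forest (t ∷ ts) a n o f =
    let (m₁ , m₂ , m₁+m₂≡n , f₁ , f₂) = splitSF f
        depth≡ = cong (λ n → a + n + o) (sym m₁+m₂≡n)
        (e₁ , t≡) = unique-tree t a m₁ (o + m₂)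
                      (subst (λ h → SimpleForest a m₁ h (t ∷ [])) (trans depth≡ (a+[m+n]+o≡a+m+[o+n] a m₁ m₂ o)) f₁)
        (e₂ , ts≡) = unique-forest ts (a + m₁) m₂ o
                      (subst (λ h → SimpleForest (a + m₁) m₂ h ts) (trans depth≡ (a+[m+n]+o≡a+m+n+o a m₁ m₂ o)) f₂)
    in trans (sym m₁+m₂≡n) (cong₂ _+_ e₁ e₂) , ∷-spreadL t ts a o (colour-ρ t (proj₁ (coloured f₁))) e₁ e₂ t≡ ts≡

  depth≤height : ∀ (t : Tree N) p {s} → t at p ≡ just s → length p ≤ height t
  depth≤height t [] e = z≤n
  depth≤height (node c ts) (i ∷ p) e with at-∷ (node c ts) i p e
  depth≤height (node c (x ∷ xs)) (i ∷ p) e | s₁ , e₁ , e₂ =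
    s≤s (≤-trans (depth≤height s₁ p e₂) (nth-height (x ∷ xs) i e₁))
    where
    nth-height : ∀ (ts : List (Tree N)) i {s} → nth ts i ≡ just s → height s ≤ heightL ts
    nth-height (t ∷ ts) zero refl = m≤m⊔n (height t) (heightL ts)
    nth-height (t ∷ ts) (suc i) e = ≤-trans (nth-height ts i e) (m≤n⊔m (height t) (heightL ts))

  parent-depth<height : ∀ (t : Tree N) p j {P} → Has (t at (p ∷ʳ j)) P → length p < height t
  parent-depth<height t p j (_ , e , _) = subst (_≤ height t) (length-∷ʳ p j) (depth≤height t (p ∷ʳ j) e)

  nonDeg-depth<height : ∀ (t : Tree N) p → Has (t at p) IsNonDeg → length p < height t
  nonDeg-depth<height t p (node c (x ∷ _ ∷ _) , e , _) =
    subst (_≤ height t) (length-∷ʳ p 0) (depth≤height t (p ∷ʳ 0) (at-∷ʳ⁻ t p 0 e refl))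
  nonDeg-depth<height t p (node c (_ ∷ []) , e , s≤s ())

  nonDeg-not-unary : ∀ (t : Tree N) p → NonDeg t p → ¬ Unary t p
  nonDeg-not-unary t p (s , e , nd) (s′ , e′ , u) with trans (sym e) e′
  ... | refl = <-irrefl (sym u) nd

  unary-parent : ∀ (t : Tree N) x j → Unary t x → NonDeg t (x ∷ʳ j) → Has (t at x) UnaryOverNonDeg
  unary-parent t x j u nd with parent-of-nonDeg t x j nd
  ... | inj₁ uo = uo
  ... | inj₂ nd-x = ⊥-elim (nonDeg-not-unary t x nd-x u)

  unaryOverNonDeg⇒unary : ∀ (t : Tree N) x → Has (t at x) UnaryOverNonDeg → Unary t x
  unaryOverNonDeg⇒unary t x (s , e , _ , kids≡ , _) = s , e , cong length kids≡

  unaryOverNonDeg-left : ∀ (T : Tree N) → Simple T → OrderReduced T →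
    ∀ x q → Has (T at x) UnaryOverNonDeg → NonDeg T q → length q ≡ length x → q ≺ x
  unaryOverNonDeg-left T S O x q u nd lq with q ≺? x
  ... | yes q≺x = q≺x
  ... | no q⊀x =
    ⊥-elim (O (x ∷ʳ 0) (nd-child , x , 0 , refl , unaryOverNonDeg⇒unary T x u , nothing-right , nothing-left))
    where
    nd-child : NonDeg T (x ∷ʳ 0)
    nd-child = child-of-unaryOverNonDeg T x u
    nothing-right : ∀ z → NonDeg T z → length z ≡ length (x ∷ʳ 0) → ¬ (x ∷ʳ 0) ≺ z
    nothing-right z nd-z lz with S z (x ∷ʳ 0) nd-z nd-child lz
    ... | refl = ≺-irrefl z
    nothing-left : ∀ z → NonDeg T z → length z ≡ length x → ¬ z ≺ x
    nothing-left z nd-z lz with S z q nd-z nd (trans lz (sym lq))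
    ... | refl = q⊀x

  SF⇒OST : ∀ {n} {T : Tree N} → SimpleForest 0 n n (T ∷ []) → Layered T × Proper T × Simple T × OrderReduced T
  SF⇒OST {n} {T} f = layered , proper , simple′ , orderReduced
    where
    layered : Layered T
    layered p q lp lq = trans (leaf-depth f 0 p lp) (sym (leaf-depth f 0 q lq))
    proper : Proper T
    proper k k<ℓ with occupied f k (subst (k <_) (height-SF f) k<ℓ)
    ... | zero , p , lp , nd = p , lp , nd
    simple′ : Simple T
    simple′ p q np nq e = proj₂ (simple f 0 p 0 q np nq e)
    orderReduced : OrderReduced T
    orderReduced x (nd , x′ , j , refl , u , _ , nothing-left) with occupied f (length x′) x′-level
      where
      x′-level : length x′ < n
      x′-level = subst (length x′ <_) (height-SF f) (parent-depth<height T x′ j nd)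
    ... | zero , z , lz , nd-z = nothing-left z nd-z lz (≺-tail (ordered f 0 x′ 0 z (unary-parent T x′ j u nd) nd-z lz))

  OST⇒SF : ∀ {T : Tree N} → Colored T → Layered T → Proper T → Simple T → OrderReduced T →
    SimpleForest 0 (height T) (height T) (T ∷ [])
  leaf-depth (OST⇒SF {T} cT L P S O) zero p lf = let (q , lq , e) = deepestLeaf T in trans (L p q lf lq) e
  occupied (OST⇒SF cT L P S O) k k< = let (p , lp , nd) = P k k< in 0 , p , lp , nd
  confined (OST⇒SF {T} cT L P S O) zero p nd = z≤n , nonDeg-depth<height T p nd
  simple (OST⇒SF cT L P S O) zero p zero q n₁ n₂ e = refl , S p q n₁ n₂ e
  ordered (OST⇒SF {T} cT L P S O) zero x zero q u nd lq = left-there (unaryOverNonDeg-left T S O x q u nd lq)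
  coloured (OST⇒SF cT L P S O) = cT , tt

  Reduced⇒ReducedTree : ∀ (t : Tree N) → Reduced t → ReducedTree t
  noUnary⇒ReducedForest : ∀ (ts : List (Tree N)) → (∀ i p → ¬ Has (forestAt ts i p) IsUnary) → ReducedForest ts
  Reduced⇒ReducedTree (node c []) _ = tt
  Reduced⇒ReducedTree (node c (_ ∷ [])) red = red [] (_ , refl , refl)
  Reduced⇒ReducedTree (node c ts@(_ ∷ _ ∷ _)) red = noUnary⇒ReducedForest ts (λ i p u → red (i ∷ p) (below⁻ c ts i p u))
  noUnary⇒ReducedForest [] _ = tt
  noUnary⇒ReducedForest (t ∷ ts) h = Reduced⇒ReducedTree t (h 0) , noUnary⇒ReducedForest ts (λ i → h (suc i))

  ReducedTree⇒Reduced : ∀ (t : Tree N) → ReducedTree t → Reduced t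
  ReducedForest⇒noUnary : ∀ (ts : List (Tree N)) → ReducedForest ts → ∀ i p → ¬ Has (forestAt ts i p) IsUnary
  ReducedTree⇒Reduced (node c []) _ p u with rootedVertex {ts = []} 0 p u
  ... | root ()
  ... | below (_ , () , _)
  ReducedTree⇒Reduced (node c ts@(_ ∷ _ ∷ _)) red p u with rootedVertex 0 p u
  ... | root ()
  ... | below {i} {p′} u′ = ReducedForest⇒noUnary ts red i p′ u′
  ReducedForest⇒noUnary (t ∷ ts) (red-t , _) zero p = ReducedTree⇒Reduced t red-t p
  ReducedForest⇒noUnary (t ∷ ts) (_ , red-ts) (suc i) p = ReducedForest⇒noUnary ts red-ts i p

  ρ-reduced : ∀ (t : Tree N) → ReducedTree (ρ t)
  ρL-reduced : ∀ (ts : List (Tree N)) → ReducedForest (ρL ts)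
  ρ-reduced (node c []) = tt
  ρ-reduced (node c (x ∷ [])) = ρ-reduced x
  ρ-reduced (node c ts@(_ ∷ _ ∷ _)) = ρL-reduced ts
  ρL-reduced [] = tt
  ρL-reduced (t ∷ ts) = ρ-reduced t , ρL-reduced ts

  ρ-coloured : ∀ (t : Tree N) → Colored t → Colored (ρ t)
  ρL-coloured : ∀ (ts : List (Tree N)) → ColoredL ts → ColoredL (ρL ts)
  ρ-coloured (node c []) _ = tt
  ρ-coloured (node c (x ∷ [])) (_ , cx) = ρ-coloured x cx
  ρ-coloured (node c ts@(_ ∷ _ ∷ _)) cts = ρL-coloured ts cts
  ρL-coloured [] _ = tt
  ρL-coloured (t ∷ ts) (ct , cts) = ρ-coloured t ct , ρL-coloured ts cts

  leafWord-ρ : ∀ (t : Tree N) → leafWord (ρ t) ≡ leafWord t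
  leafWordL-ρL : ∀ (ts : List (Tree N)) → leafWordL (ρL ts) ≡ leafWordL ts
  leafWord-ρ (node c []) = refl
  leafWord-ρ (node c (x ∷ [])) = trans (leafWord-ρ x) (sym (++-identityʳ _))
  leafWord-ρ (node c ts@(_ ∷ _ ∷ _)) = leafWordL-ρL ts
  leafWordL-ρL [] = refl
  leafWordL-ρL (t ∷ ts) = cong₂ _++_ (leafWord-ρ t) (leafWordL-ρL ts)

  leafWord-pad : ∀ c k (X : Tree N) → leafWord (pad c k X) ≡ leafWord X
  leafWord-pad c zero X = refl
  leafWord-pad c (suc k) X = trans (++-identityʳ _) (leafWord-pad c k X)

  leafWord-spread : ∀ o (t : Tree N) → leafWord (spread o t) ≡ leafWord t
  leafWordL-spreadL : ∀ a o (ts : List (Tree N)) → leafWordL (spreadL a o ts) ≡ leafWordL ts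
  leafWord-spread o (node c []) = leafWord-pad c o (node c [])
  leafWord-spread o (node c ts@(_ ∷ _)) = leafWordL-spreadL 0 o ts
  leafWordL-spreadL a o [] = refl
  leafWordL-spreadL a o (t ∷ ts) = cong₂ _++_ (trans (leafWord-pad _ a _) (leafWord-spread _ t)) (leafWordL-spreadL _ o ts)

  nonDegY-++ : ∀ (xs ys : List (Tree N)) → nonDegY (xs ++ ys) ≡ nonDegY xs ++ nonDegY ys
  nonDegY-++ [] ys = refl
  nonDegY-++ (node c [] ∷ xs) ys = nonDegY-++ xs ys
  nonDegY-++ (node c (_ ∷ []) ∷ xs) ys = nonDegY-++ xs ys
  nonDegY-++ (node c (_ ∷ _ ∷ _) ∷ xs) ys = cong (_ ∷_) (nonDegY-++ xs ys)

  levelY : ℕ → Tree N → List (Gen {N})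
  levelY k t = nonDegY (level k t)

  levelYL : ℕ → List (Tree N) → List (Gen {N})
  levelYL k ts = nonDegY (levelL k ts)

  levelYL-∷ : ∀ k (t : Tree N) ts → levelYL k (t ∷ ts) ≡ levelY k t ++ levelYL k ts
  levelYL-∷ k t ts = nonDegY-++ (level k t) (levelL k ts)

  levelY-pad : ∀ c a k (X : Tree N) → levelY (suc k) (pad c (suc a) X) ≡ levelY k (pad c a X)
  levelY-pad c a k X = trans (levelYL-∷ k (pad c a X) []) (++-identityʳ _)

  levelY-chain : ∀ k c o → levelY k (pad c o (node c [])) ≡ []
  levelY-chain zero c zero = refl
  levelY-chain (suc k) c zero = refl
  levelY-chain zero c (suc o) = refl
  levelY-chain (suc k) c (suc o) = trans (levelY-pad c o k (node c [])) (levelY-chain k c o)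

  map-colour-spreadL : ∀ a o (ts : List (Tree N)) → map colour (spreadL a o ts) ≡ map colour ts
  map-colour-spreadL a o [] = refl
  map-colour-spreadL a o (t ∷ ts) = cong₂ _∷_ (colour-pad (colour t) a _ (colour-spread _ t)) (map-colour-spreadL _ o ts)

  levelY-spread-outside : ∀ o (t : Tree N) → ReducedTree t →
    ∀ k → nonLeafCount t ≤ k → levelY k (spread o t) ≡ []
  levelYL-spreadL-outside : ∀ a o (ts : List (Tree N)) → ReducedForest ts →
    ∀ k → Outside a (nonLeafCountL ts) k → levelYL k (spreadL a o ts) ≡ []
  levelY-padSpread-outside : ∀ c a o (t : Tree N) → ReducedTree t →
    ∀ k → Outside a (nonLeafCount t) k → levelY k (pad c a (spread o t)) ≡ []
  levelY-spread-outside o (node c []) _ k _ = levelY-chain k c o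
  levelY-spread-outside o (node c ts@(_ ∷ _ ∷ _)) red (suc k) (s≤s v≤k) =
    levelYL-spreadL-outside 0 o ts red k (inj₂ v≤k)
  levelYL-spreadL-outside a o [] _ k _ = refl
  levelYL-spreadL-outside a o (t ∷ ts) (red-t , red-ts) k out =
    trans (levelYL-∷ k (pad (colour t) a (spread (o + nonLeafCountL ts) t)) (spreadL (a + nonLeafCount t) o ts))
          (cong₂ _++_ (levelY-padSpread-outside (colour t) a _ t red-t k out-t)
                      (levelYL-spreadL-outside _ o ts red-ts k out-ts))
    where
    out-t : Outside a (nonLeafCount t) k
    out-t = map₂ (≤-trans (+-monoʳ-≤ a (m≤m+n _ _))) out
    out-ts : Outside (a + nonLeafCount t) (nonLeafCountL ts) k
    out-ts = map⊎ (λ k<a → <-≤-trans k<a (m≤m+n a _)) (subst (_≤ k) (sym (+-assoc a _ _))) out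
  levelY-padSpread-outside c zero o t red k (inj₂ v≤k) = levelY-spread-outside o t red k v≤k
  levelY-padSpread-outside c (suc a) o t red zero _ = refl
  levelY-padSpread-outside c (suc a) o t red (suc k) out =
    trans (levelY-pad c a k _) (levelY-padSpread-outside c a o t red k (map⊎ s≤s⁻¹ s≤s⁻¹ out))

  levels-spread : ∀ o (t : Tree N) → ReducedTree t → ∀ m → nonLeafCount t ≤ m →
    concatDown (λ k → levelY k (spread o t)) m ≡ ΛR t
  levels-spreadL : ∀ a o (ts : List (Tree N)) → ReducedForest ts → ∀ m → a + nonLeafCountL ts ≤ m →
    concatDown (λ k → levelYL k (spreadL a o ts)) m ≡ ΛRL ts
  levels-padSpread : ∀ c a o (t : Tree N) → ReducedTree t → ∀ m → a + nonLeafCount t ≤ m →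
    concatDown (λ k → levelY k (pad c a (spread o t))) m ≡ ΛR t
  levels-spread o (node c []) _ m _ = concatDown-[] _ m (λ k _ → levelY-chain k c o)
  levels-spread o (node c ts@(_ ∷ _ ∷ _)) red (suc m) (s≤s v≤m) =
    trans (concatDown-suc _ m)
          (cong₂ _++_ (levels-spreadL 0 o ts red m v≤m) (cong (λ cs → (c , cs) ∷ []) (map-colour-spreadL 0 o ts)))
  levels-spreadL a o [] _ m _ = concatDown-[] _ m (λ k _ → refl)
  levels-spreadL a o (t ∷ ts) (red-t , red-ts) m v≤m =
    begin
      concatDown (λ k → levelYL k (T ∷ Ts)) m
    ≡⟨ concatDown-cong m (λ k → levelYL-∷ k T Ts) ⟩
      concatDown (λ k → levelY k T ++ levelYL k Ts) m
    ≡⟨ concatDown-++ (λ k → levelY k T) (λ k → levelYL k Ts) (a + nonLeafCount t) m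
         (λ k v≤k → levelY-padSpread-outside (colour t) a _ t red-t k (inj₂ v≤k))
         (λ k k<v → levelYL-spreadL-outside (a + nonLeafCount t) o ts red-ts k (inj₁ k<v)) ⟩
      concatDown (λ k → levelYL k Ts) m ++ concatDown (λ k → levelY k T) m
    ≡⟨ cong₂ _++_ (levels-spreadL _ o ts red-ts m (subst (_≤ m) (sym (+-assoc a _ _)) v≤m))
                  (levels-padSpread (colour t) a _ t red-t m (≤-trans (+-monoʳ-≤ a (m≤m+n _ _)) v≤m)) ⟩
      ΛRL ts ++ ΛR t
    ∎
    where
    open ≡-Reasoning
    T = pad (colour t) a (spread (o + nonLeafCountL ts) t)
    Ts = spreadL (a + nonLeafCount t) o ts
  levels-padSpread c zero o t red m v≤m = levels-spread o t red m v≤m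
  levels-padSpread c (suc a) o t red (suc m) (s≤s v≤m) =
    trans (concatDown-suc _ m)
          (trans (++-identityʳ _)
                 (trans (concatDown-cong m (λ k → levelY-pad c a k _)) (levels-padSpread c a o t red m v≤m)))

  ◁R-asym : ∀ {x y} → _◁R_ {N} x y → ¬ _◁R_ {N} y x
  ◁R-asym (inj₁ y⊏x) (inj₁ x⊏y) = <-asym (⊏-shorter y⊏x) (⊏-shorter x⊏y)
  ◁R-asym (inj₁ y⊏x) (inj₂ x≺y) = ⊏-≺-⊥ y⊏x x≺y
  ◁R-asym (inj₂ y≺x) (inj₁ x⊏y) = ⊏-≺-⊥ x⊏y y≺x
  ◁R-asym (inj₂ y≺x) (inj₂ x≺y) = ≺-asym y≺x x≺y

  ◁R-irrefl : ∀ x → ¬ _◁R_ {N} x x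
  ◁R-irrefl x x◁x = ◁R-asym x◁x x◁x

  OrdersAgree : Tree N → Set
  OrdersAgree T = ∀ x y → NonDeg T x → NonDeg T y → (_≪_ {N} x y ⇔ _◁R_ {N} x y)

  module _ {T : Tree N} (P : Proper T) where

    ordersAgree⇒simple : OrdersAgree T → Simple T
    ordersAgree⇒simple agree p q nd-p nd-q lp =
      ≺-connex p q lp (incomparable p q nd-p nd-q lp) (incomparable q p nd-q nd-p (sym lp))
      where
      incomparable : ∀ p q → NonDeg T p → NonDeg T q → length p ≡ length q → ¬ p ≺ q
      incomparable p q nd-p nd-q lp p≺q with Equivalence.to (agree p q nd-p nd-q) (inj₂ (lp , p≺q))
      ... | inj₁ q⊏p = <-irrefl (sym lp) (⊏-shorter q⊏p)
      ... | inj₂ q≺p = ≺-asym p≺q q≺p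

    ordersAgree⇒orderReduced : OrdersAgree T → OrderReduced T
    ordersAgree⇒orderReduced agree x (nd , x′ , j , refl , u , _ , nothing-left)
      with P (length x′) (parent-depth<height T x′ j nd)
    ... | z , lz , nd-z with Equivalence.to (agree (x′ ∷ʳ j) z nd nd-z) (inj₁ x-deeper)
      where
      x-deeper : length z < length (x′ ∷ʳ j)
      x-deeper = subst₂ _<_ (sym lz) (sym (length-∷ʳ x′ j)) ≤-refl
    ...   | inj₁ z⊏x = nonDeg-not-unary T x′ (subst (NonDeg T) (⊏-∷ʳ-sameLength z x′ j z⊏x lz) nd-z) u
    ...   | inj₂ z≺x = nothing-left z nd-z lz (≺-∷ʳ⁻ z x′ j z≺x lz)

    module _ (S : Simple T) (O : OrderReduced T) where

      ◁R-parentLevel : ∀ x′ j z → NonDeg T (x′ ∷ʳ j) → NonDeg T z → length z ≡ length x′ → _◁R_ {N} (x′ ∷ʳ j) z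
      ◁R-parentLevel x′ j z nd nd-z lz with parent-of-nonDeg T x′ j nd
      ... | inj₁ u = inj₂ (≺-∷ʳ⁺ j (unaryOverNonDeg-left T S O x′ z u nd-z lz))
      ... | inj₂ nd-x′ = inj₁ (subst (_⊏ (x′ ∷ʳ j)) (S x′ z nd-x′ nd-z (sym lz)) (⊏-∷ʳ x′ j))

      deeper⇒◁R : ∀ n x y → length x ≡ n → NonDeg T x → NonDeg T y → length y < length x → _◁R_ {N} x y
      deeper⇒◁R zero x y lx nd-x nd-y ly<lx = ⊥-elim (n≮0 (subst (length y <_) lx ly<lx))
      deeper⇒◁R (suc n) x y lx nd-x nd-y ly<lx with initLast x
      ... | x′ ∷ʳ′ j with P (length x′) (parent-depth<height T x′ j nd-x)
      ...   | z , lz , nd-z with m≤n⇒m<n∨m≡n (s≤s⁻¹ (subst (length y <_) (length-∷ʳ x′ j) ly<lx))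
      ...     | inj₂ ly≡lx′ =
        subst (_◁R_ (x′ ∷ʳ j)) (S z y nd-z nd-y (trans lz (sym ly≡lx′))) (◁R-parentLevel x′ j z nd-x nd-z lz)
      ...     | inj₁ ly<lx′ =
        ◁R-trans (◁R-parentLevel x′ j z nd-x nd-z lz)
                 (deeper⇒◁R n z y (trans lz (suc-injective (trans (sym (length-∷ʳ x′ j)) lx))) nd-z nd-y
                            (subst (length y <_) (sym lz) ly<lx′))

      simple-orderReduced⇒ordersAgree : OrdersAgree T
      simple-orderReduced⇒ordersAgree x y nd-x nd-y = mk⇔ ≪⇒◁R ◁R⇒≪
        where
        ≪⇒◁R : _≪_ {N} x y → _◁R_ {N} x y
        ≪⇒◁R (inj₁ deeper) = deeper⇒◁R (length x) x y refl nd-x nd-y deeper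
        ≪⇒◁R (inj₂ (lx , x≺y)) with S x y nd-x nd-y lx
        ... | refl = ⊥-elim (≺-irrefl x x≺y)
        ◁R⇒≪ : _◁R_ {N} x y → _≪_ {N} x y
        ◁R⇒≪ x◁y with <-cmp (length x) (length y)
        ... | tri> _ _ deeper = inj₁ deeper
        ... | tri< shallower _ _ = ⊥-elim (◁R-asym x◁y (deeper⇒◁R (length y) y x refl nd-y nd-x shallower))
        ... | tri≈ _ lx _ with S x y nd-x nd-y lx
        ...   | refl = ⊥-elim (◁R-irrefl x x◁y)

    ordersAgree⇔simple-orderReduced : OrdersAgree T ⇔ (Simple T × OrderReduced T)
    ordersAgree⇔simple-orderReduced =
      mk⇔ (λ agree → ordersAgree⇒simple agree , ordersAgree⇒orderReduced agree)
          (λ (S , O) → simple-orderReduced⇒ordersAgree S O)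

  OST⇒spread : ∀ {i u} (T : Tree N) → OST i u T → T ≡ spread 0 (ρ T)
  OST⇒spread T (cT , L , P , S , O , _) =
    proj₂ (unique-tree T 0 (height T) 0
            (subst (λ h → SimpleForest 0 (height T) h (T ∷ [])) (sym (+-identityʳ _)) (OST⇒SF cT L P S O)))

  spread₀SF : ∀ (T : Tree N) → ReducedTree T → SimpleForest 0 (nonLeafCount T) (nonLeafCount T) (spread 0 T ∷ [])
  spread₀SF T red = subst (λ h → SimpleForest 0 (nonLeafCount T) h (spread 0 T ∷ [])) (+-identityʳ _) (spreadSF T 0 red)

  ρ-OST⇒RT : ∀ {i u} (T : Tree N) → OST i u T → RT i u (ρ T)
  ρ-OST⇒RT T (cT , _ , _ , _ , _ , root-colour , leaves) =
    ρ-coloured T cT , ReducedTree⇒Reduced (ρ T) (ρ-reduced T) ,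
    trans (colour-ρ T cT) root-colour , trans (leafWord-ρ T) leaves

  RT⇒spread-OST : ∀ {i u} (T : Tree N) → RT i u T → OST i u (spread 0 T)
  RT⇒spread-OST T (cT , R , root-colour , leaves) =
    let f = spread₀SF T (Reduced⇒ReducedTree T R)
        (L , P , S , O) = SF⇒OST f
    in proj₁ (coloured f) , L , P , S , O , trans (colour-spread 0 T) root-colour , trans (leafWord-spread 0 T) leaves

  height-spread₀ : ∀ (T : Tree N) → ReducedTree T → height (spread 0 T) ≡ nonLeafCount T
  height-spread₀ T red = height-SF (spread₀SF T red)

  Ω-spread₀ : ∀ (T : Tree N) → ReducedTree T → Ω (spread 0 T) ≡ ΛR T
  Ω-spread₀ T red =
    levels-spread 0 T red (suc (height (spread 0 T))) (subst (_≤ suc (height (spread 0 T))) (height-spread₀ T red) (n≤1+n _))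

theorem13 : (N : ℕ) → 1 ≤ N →
    -- (a)
    ((T : Tree N) → Colored T → ProperLayered T →
      ((∀ x y → NonDeg T x → NonDeg T y → (_≪_ {N} x y ⇔ _◁R_ {N} x y))
        ⇔ (Simple T × OrderReduced T)))
    ×
    -- (b)
    ((i : Fin N) (u : List (Fin N)) →
      ((T : Tree N) → OST i u T → RT i u (ρ T))
      × ((T T′ : Tree N) → OST i u T → OST i u T′ → ρ T ≡ ρ T′ → T ≡ T′)
      × ((T : Tree N) → RT i u T → Σ (Tree N) λ T′ → OST i u T′ × (ρ T′ ≡ T)))
    ×
    -- (c)
    ((i : Fin N) (u : List (Fin N)) (T T′ : Tree N) →
      RT i u T → OST i u T′ → ρ T′ ≡ T →
      (Ω T′ ≡ ΛR T) × (ℓ T′ ≡ nonLeafCount T))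
theorem13 N _ =
  (λ T _ (_ , P) → ordersAgree⇔simple-orderReduced P) ,
  (λ i u →
    ρ-OST⇒RT ,
    (λ T T′ ost ost′ ρT≡ρT′ → trans (OST⇒spread T ost) (trans (cong (spread 0) ρT≡ρT′) (sym (OST⇒spread T′ ost′)))) ,
    (λ T rt → spread 0 T , RT⇒spread-OST T rt , ρ-spread 0 T (Reduced⇒ReducedTree T (proj₁ (proj₂ rt))))) ,
  (λ i u T T′ rt ost ρT′≡T →
    let red = Reduced⇒ReducedTree T (proj₁ (proj₂ rt))
        T′≡ = trans (OST⇒spread T′ ost) (cong (spread 0) ρT′≡T)
    in trans (cong Ω T′≡) (Ω-spread₀ T red) , trans (cong height T′≡) (height-spread₀ T red))
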